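{- There exist a graded Kleene algebra with tests $(K,T,+,;,{}^*,\rightarrow,0,1)$ and elements $b\in T$, $p\in K$ such that $b;p;(b\rightarrow0)+(b\rightarrow0);p;b=0$ but $(b\rightarrow0);p\neq p;(b\rightarrow0)$.
   Context: A graded Kleene algebra with tests (GKAT) is a tuple $(K,T,+,;,{}^*,\rightarrow,0,1)$ where $K$ is a set, $T\subseteq K$, $0,1\in T$, $+$ and $;$ are binary operations on $K$ under which $T$ is closed, ${}^*$ is unary on $K$, and $\rightarrow$ is a binary operation on $T$ with values in $T$, such that for all $p,q,r\in K$ and $a,b,c\in T$: $p+(q+r)=(p+q)+r$; $p+q=q+p$; $p;(q;r)=(p;q);r$; $p;1=1;p=p$; $p;(q+r)=p;q+p;r$; $(p+q);r=p;r+q;r$; $p;0=0;p=0$; $1+p;p^*=p^*$; $q+p;r\leq r\Rightarrow p^*;q\leq r$; $q+r;p\leq r\Rightarrow q;p^*\leq r$; $a;b\leq c\Leftrightarrow b\leq a\rightarrow c$; $a\leq 1$; $a;b=b;a$, where $p\leq q$ means $p+q=q$. -}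

module Defs where

open import Level using (suc; _⊔_)
open import Relation.Binary.PropositionalEquality using (_≡_)
open import Data.Product using (_×_)

record GKAT (c ℓ : Level.Level) : Set (suc (c ⊔ ℓ)) where
  infixl 6 _+_
  infixl 7 _⨾_
  infix 4 _≤_
  field
    K    : Set c
    T    : K → Set ℓ
    _+_  : K → K → K
    _⨾_  : K → K → K
    _*   : K → K
    0#   : K
    1#   : K
    0∈T  : T 0#
    1∈T  : T 1#
    +-closed : ∀ {a b} → T a → T b → T (a + b)
    ⨾-closed : ∀ {a b} → T a → T b → T (a ⨾ b)
    _⇒_  : ∀ {a b} → T a → T b → K
    ⇒-closed : ∀ {a b} (ta : T a) (tb : T b) → T (ta ⇒ tb)

  _≤_ : K → K → Set c
  p ≤ q = p + q ≡ q

  field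
    +-assoc : ∀ p q r → p + (q + r) ≡ (p + q) + r
    +-comm  : ∀ p q → p + q ≡ q + p
    ⨾-assoc : ∀ p q r → p ⨾ (q ⨾ r) ≡ (p ⨾ q) ⨾ r
    ⨾-identityʳ : ∀ p → p ⨾ 1# ≡ p
    ⨾-identityˡ : ∀ p → 1# ⨾ p ≡ p
    distribˡ : ∀ p q r → p ⨾ (q + r) ≡ p ⨾ q + p ⨾ r
    distribʳ : ∀ p q r → (p + q) ⨾ r ≡ p ⨾ r + q ⨾ r
    zeroʳ : ∀ p → p ⨾ 0# ≡ 0#
    zeroˡ : ∀ p → 0# ⨾ p ≡ 0#
    star-unfold : ∀ p → 1# + p ⨾ (p *) ≡ p *
    star-indˡ : ∀ p q r → q + p ⨾ r ≤ r → (p *) ⨾ q ≤ r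
    star-indʳ : ∀ p q r → q + r ⨾ p ≤ r → q ⨾ (p *) ≤ r
    residual→ : ∀ {a b c} (ta : T a) (tb : T b) (tc : T c) →
                a ⨾ b ≤ c → b ≤ ta ⇒ tc
    residual← : ∀ {a b c} (ta : T a) (tb : T b) (tc : T c) →
                b ≤ ta ⇒ tc → a ⨾ b ≤ c
    test-≤1 : ∀ {a} → T a → a ≤ 1#
    test-comm : ∀ {a b} → T a → T b → a ⨾ b ≡ b ⨾ a

-- Take the relations on {1,2,3} contained in the diagonal together with the pair (2,3),
-- under union and composition. Every p satisfies p ⨟ p ⊆ 𝟙 ∪ p, so p⋆ = 𝟙 ∪ p is a star.
-- The tests are not all subidentities, only those whose support is a down-set of the order
-- 1, 2 < 3; they form a Heyting algebra that is not Boolean, with → the Heyting implication.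
-- For b = {1} the largest test disjoint from b is then {2} rather than {2,3}, and for
-- p = {(2,3)} we get b ⨟ p = p ⨟ b = ∅ while {2} ⨟ p = p but p ⨟ {2} = ∅.
module Submission where

open import Defs
open import Level using (0ℓ)
open import Data.Bool using (Bool; true; false; not; _∧_; _∨_; _≤_; b≤b; f≤t)
open import Data.Bool.Properties
  using (∨-assoc; ∨-comm; ∨-identityʳ; ∧-zeroʳ; ∧-identityʳ; ∧-assoc; ∧-comm; ∧-distribˡ-∨; ∧-distribʳ-∨;
         ≤-refl; ≤-trans; ≤-minimum; ≤-maximum; ∨-∧-commutativeSemiring)
open import Data.Product using (Σ; _×_; _,_)
open import Relation.Binary.PropositionalEquality
  using (_≡_; _≢_; refl; sym; trans; cong; subst; module ≡-Reasoning)
open import Algebra.Solver.Ring.NaturalCoefficients.Default ∨-∧-commutativeSemiring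
  using (solve; _:+_; _:*_; _:=_)

x∨y≡y⇒x≤y : ∀ {x y} → x ∨ y ≡ y → x ≤ y
x∨y≡y⇒x≤y {false} {y} _ = ≤-minimum y
x∨y≡y⇒x≤y {true} refl = b≤b

x≤y⇒x∨y≡y : ∀ {x y} → x ≤ y → x ∨ y ≡ y
x≤y⇒x∨y≡y {false} _ = refl
x≤y⇒x∨y≡y {true} b≤b = refl

x≤x∨y : ∀ x y → x ≤ x ∨ y
x≤x∨y false y = ≤-minimum y
x≤x∨y true y = b≤b

y≤x∨y : ∀ x y → y ≤ x ∨ y
y≤x∨y false y = ≤-refl
y≤x∨y true y = ≤-maximum y

∨-least : ∀ {x y z} → x ≤ z → y ≤ z → x ∨ y ≤ z
∨-least {false} _ q = q
∨-least {true} p _ = p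

x∧y≤x : ∀ x y → x ∧ y ≤ x
x∧y≤x false y = b≤b
x∧y≤x true y = ≤-maximum y

x∧y≤y : ∀ x y → x ∧ y ≤ y
x∧y≤y false y = ≤-minimum y
x∧y≤y true y = ≤-refl

∧-greatest : ∀ {x y z} → x ≤ y → x ≤ z → x ≤ y ∧ z
∧-greatest {false} {y} {z} _ _ = ≤-minimum (y ∧ z)
∧-greatest {true} b≤b q = q

∧-mono-≤ : ∀ {x x′ y y′} → x ≤ x′ → y ≤ y′ → x ∧ y ≤ x′ ∧ y′
∧-mono-≤ {false} {x′} {y′ = y′} _ _ = ≤-minimum (x′ ∧ y′)
∧-mono-≤ {true} b≤b q = q

∨-mono-≤ : ∀ {x x′ y y′} → x ≤ x′ → y ≤ y′ → x ∨ y ≤ x′ ∨ y′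
∨-mono-≤ {x′ = x′} p q = ∨-least (≤-trans p (x≤x∨y x′ _)) (≤-trans q (y≤x∨y x′ _))

infixr 5 _⇒ᵇ_

_⇒ᵇ_ : Bool → Bool → Bool
x ⇒ᵇ y = not x ∨ y

∧-residual→ : ∀ {x y z} → x ∧ y ≤ z → y ≤ x ⇒ᵇ z
∧-residual→ {false} {y} _ = ≤-maximum y
∧-residual→ {true} p = p

∧-residual← : ∀ {x y z} → y ≤ x ⇒ᵇ z → x ∧ y ≤ z
∧-residual← {false} {z = z} _ = ≤-minimum z
∧-residual← {true} p = p

record Rel : Set where
  constructor rel
  field
    r₁₁ r₂₂ r₃₃ r₂₃ : Bool

infixl 6 _∪_
infixl 7 _⨟_

_∪_ : Rel → Rel → Rel
rel p₁ p₂ p₃ p₂₃ ∪ rel q₁ q₂ q₃ q₂₃ = rel (p₁ ∨ q₁) (p₂ ∨ q₂) (p₃ ∨ q₃) (p₂₃ ∨ q₂₃)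

-- The (2,3) entry is written with q₂₃ first so that it vanishes definitionally on tests.
_⨟_ : Rel → Rel → Rel
rel p₁ p₂ p₃ p₂₃ ⨟ rel q₁ q₂ q₃ q₂₃ =
  rel (p₁ ∧ q₁) (p₂ ∧ q₂) (p₃ ∧ q₃) ((q₂₃ ∧ p₂) ∨ (p₂₃ ∧ q₃))

∅ 𝟙 : Rel
∅ = rel false false false false
𝟙 = rel true true true false

_⋆ : Rel → Rel
p ⋆ = 𝟙 ∪ p

rel-cong : ∀ {p₁ p₂ p₃ p₂₃ q₁ q₂ q₃ q₂₃} →
           p₁ ≡ q₁ → p₂ ≡ q₂ → p₃ ≡ q₃ → p₂₃ ≡ q₂₃ → rel p₁ p₂ p₃ p₂₃ ≡ rel q₁ q₂ q₃ q₂₃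
rel-cong refl refl refl refl = refl

∪-assoc : ∀ p q r → p ∪ (q ∪ r) ≡ (p ∪ q) ∪ r
∪-assoc (rel p₁ p₂ p₃ p₂₃) (rel q₁ q₂ q₃ q₂₃) (rel r₁ r₂ r₃ r₂₃) =
  rel-cong (sym (∨-assoc p₁ q₁ r₁)) (sym (∨-assoc p₂ q₂ r₂))
           (sym (∨-assoc p₃ q₃ r₃)) (sym (∨-assoc p₂₃ q₂₃ r₂₃))

∪-comm : ∀ p q → p ∪ q ≡ q ∪ p
∪-comm (rel p₁ p₂ p₃ p₂₃) (rel q₁ q₂ q₃ q₂₃) =
  rel-cong (∨-comm p₁ q₁) (∨-comm p₂ q₂) (∨-comm p₃ q₃) (∨-comm p₂₃ q₂₃)

⨟-assoc : ∀ p q r → p ⨟ (q ⨟ r) ≡ (p ⨟ q) ⨟ r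
⨟-assoc (rel p₁ p₂ p₃ p₂₃) (rel q₁ q₂ q₃ q₂₃) (rel r₁ r₂ r₃ r₂₃) =
  rel-cong (sym (∧-assoc p₁ q₁ r₁)) (sym (∧-assoc p₂ q₂ r₂)) (sym (∧-assoc p₃ q₃ r₃))
    (solve 7 (λ p₂ q₂ q₃ r₃ p₂₃ q₂₃ r₂₃ →
                (r₂₃ :* q₂ :+ q₂₃ :* r₃) :* p₂ :+ p₂₃ :* (q₃ :* r₃)
             := r₂₃ :* (p₂ :* q₂) :+ (q₂₃ :* p₂ :+ p₂₃ :* q₃) :* r₃)
           refl p₂ q₂ q₃ r₃ p₂₃ q₂₃ r₂₃)

⨟-distribˡ-∪ : ∀ p q r → p ⨟ (q ∪ r) ≡ p ⨟ q ∪ p ⨟ r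
⨟-distribˡ-∪ (rel p₁ p₂ p₃ p₂₃) (rel q₁ q₂ q₃ q₂₃) (rel r₁ r₂ r₃ r₂₃) =
  rel-cong (∧-distribˡ-∨ p₁ q₁ r₁) (∧-distribˡ-∨ p₂ q₂ r₂) (∧-distribˡ-∨ p₃ q₃ r₃)
    (solve 6 (λ p₂ q₃ r₃ p₂₃ q₂₃ r₂₃ →
                (q₂₃ :+ r₂₃) :* p₂ :+ p₂₃ :* (q₃ :+ r₃)
             := (q₂₃ :* p₂ :+ p₂₃ :* q₃) :+ (r₂₃ :* p₂ :+ p₂₃ :* r₃))
           refl p₂ q₃ r₃ p₂₃ q₂₃ r₂₃)

⨟-distribʳ-∪ : ∀ p q r → (p ∪ q) ⨟ r ≡ p ⨟ r ∪ q ⨟ r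
⨟-distribʳ-∪ (rel p₁ p₂ p₃ p₂₃) (rel q₁ q₂ q₃ q₂₃) (rel r₁ r₂ r₃ r₂₃) =
  rel-cong (∧-distribʳ-∨ r₁ p₁ q₁) (∧-distribʳ-∨ r₂ p₂ q₂) (∧-distribʳ-∨ r₃ p₃ q₃)
    (solve 6 (λ p₂ q₂ r₃ p₂₃ q₂₃ r₂₃ →
                r₂₃ :* (p₂ :+ q₂) :+ (p₂₃ :+ q₂₃) :* r₃
             := (r₂₃ :* p₂ :+ p₂₃ :* r₃) :+ (r₂₃ :* q₂ :+ q₂₃ :* r₃))
           refl p₂ q₂ r₃ p₂₃ q₂₃ r₂₃)

⨟-identityˡ : ∀ p → 𝟙 ⨟ p ≡ p
⨟-identityˡ (rel p₁ p₂ p₃ p₂₃) =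
  rel-cong refl refl refl (trans (∨-identityʳ (p₂₃ ∧ true)) (∧-identityʳ p₂₃))

⨟-identityʳ : ∀ p → p ⨟ 𝟙 ≡ p
⨟-identityʳ (rel p₁ p₂ p₃ p₂₃) =
  rel-cong (∧-identityʳ p₁) (∧-identityʳ p₂) (∧-identityʳ p₃) (∧-identityʳ p₂₃)

⨟-zeroˡ : ∀ p → ∅ ⨟ p ≡ ∅
⨟-zeroˡ (rel p₁ p₂ p₃ p₂₃) =
  rel-cong refl refl refl (trans (∨-identityʳ (p₂₃ ∧ false)) (∧-zeroʳ p₂₃))

⨟-zeroʳ : ∀ p → p ⨟ ∅ ≡ ∅
⨟-zeroʳ (rel p₁ p₂ p₃ p₂₃) =
  rel-cong (∧-zeroʳ p₁) (∧-zeroʳ p₂) (∧-zeroʳ p₃) (∧-zeroʳ p₂₃)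

infix 4 _⊆_

data _⊆_ : Rel → Rel → Set where
  ⊆-rel : ∀ {p₁ p₂ p₃ p₂₃ q₁ q₂ q₃ q₂₃} →
          p₁ ≤ q₁ → p₂ ≤ q₂ → p₃ ≤ q₃ → p₂₃ ≤ q₂₃ → rel p₁ p₂ p₃ p₂₃ ⊆ rel q₁ q₂ q₃ q₂₃

∪≡⇒⊆ : ∀ {p q} → p ∪ q ≡ q → p ⊆ q
∪≡⇒⊆ {rel _ _ _ _} {rel _ _ _ _} eq =
  ⊆-rel (x∨y≡y⇒x≤y (cong Rel.r₁₁ eq)) (x∨y≡y⇒x≤y (cong Rel.r₂₂ eq))
        (x∨y≡y⇒x≤y (cong Rel.r₃₃ eq)) (x∨y≡y⇒x≤y (cong Rel.r₂₃ eq))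

⊆⇒∪≡ : ∀ {p q} → p ⊆ q → p ∪ q ≡ q
⊆⇒∪≡ (⊆-rel h₁ h₂ h₃ h₂₃) =
  rel-cong (x≤y⇒x∨y≡y h₁) (x≤y⇒x∨y≡y h₂) (x≤y⇒x∨y≡y h₃) (x≤y⇒x∨y≡y h₂₃)

⊆-trans : ∀ {p q r} → p ⊆ q → q ⊆ r → p ⊆ r
⊆-trans (⊆-rel g₁ g₂ g₃ g₂₃) (⊆-rel h₁ h₂ h₃ h₂₃) =
  ⊆-rel (≤-trans g₁ h₁) (≤-trans g₂ h₂) (≤-trans g₃ h₃) (≤-trans g₂₃ h₂₃)

p⊆p∪q : ∀ p q → p ⊆ p ∪ q
p⊆p∪q (rel p₁ p₂ p₃ p₂₃) (rel q₁ q₂ q₃ q₂₃) =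
  ⊆-rel (x≤x∨y p₁ q₁) (x≤x∨y p₂ q₂) (x≤x∨y p₃ q₃) (x≤x∨y p₂₃ q₂₃)

q⊆p∪q : ∀ p q → q ⊆ p ∪ q
q⊆p∪q (rel p₁ p₂ p₃ p₂₃) (rel q₁ q₂ q₃ q₂₃) =
  ⊆-rel (y≤x∨y p₁ q₁) (y≤x∨y p₂ q₂) (y≤x∨y p₃ q₃) (y≤x∨y p₂₃ q₂₃)

∪-least : ∀ {p q r} → p ⊆ r → q ⊆ r → p ∪ q ⊆ r
∪-least (⊆-rel g₁ g₂ g₃ g₂₃) (⊆-rel h₁ h₂ h₃ h₂₃) =
  ⊆-rel (∨-least g₁ h₁) (∨-least g₂ h₂) (∨-least g₃ h₃) (∨-least g₂₃ h₂₃)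

⨟-mono-⊆ : ∀ {p p′ q q′} → p ⊆ p′ → q ⊆ q′ → p ⨟ q ⊆ p′ ⨟ q′
⨟-mono-⊆ (⊆-rel g₁ g₂ g₃ g₂₃) (⊆-rel h₁ h₂ h₃ h₂₃) =
  ⊆-rel (∧-mono-≤ g₁ h₁) (∧-mono-≤ g₂ h₂) (∧-mono-≤ g₃ h₃)
        (∨-mono-≤ (∧-mono-≤ h₂₃ g₂) (∧-mono-≤ g₂₃ h₃))

⊆-refl : ∀ {p} → p ⊆ p
⊆-refl {rel _ _ _ _} = ⊆-rel ≤-refl ≤-refl ≤-refl ≤-refl

p⨟p⊆p⋆ : ∀ p → p ⨟ p ⊆ p ⋆
p⨟p⊆p⋆ (rel p₁ p₂ p₃ p₂₃) =
  ⊆-rel (≤-maximum _) (≤-maximum _) (≤-maximum _) (∨-least (x∧y≤x p₂₃ p₂) (x∧y≤x p₂₃ p₃))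

⋆-unfold : ∀ p → 𝟙 ∪ p ⨟ p ⋆ ≡ p ⋆
⋆-unfold p = begin
  𝟙 ∪ p ⨟ (𝟙 ∪ p)      ≡⟨ cong (𝟙 ∪_) (⨟-distribˡ-∪ p 𝟙 p) ⟩
  𝟙 ∪ (p ⨟ 𝟙 ∪ p ⨟ p)  ≡⟨ cong (λ x → 𝟙 ∪ (x ∪ p ⨟ p)) (⨟-identityʳ p) ⟩
  𝟙 ∪ (p ∪ p ⨟ p)      ≡⟨ ∪-assoc 𝟙 p (p ⨟ p) ⟩
  p ⋆ ∪ p ⨟ p          ≡⟨ ∪-comm (p ⋆) (p ⨟ p) ⟩
  p ⨟ p ∪ p ⋆          ≡⟨ ⊆⇒∪≡ (p⨟p⊆p⋆ p) ⟩
  p ⋆                  ∎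
  where open ≡-Reasoning

⋆-expandˡ : ∀ p q → p ⋆ ⨟ q ≡ q ∪ p ⨟ q
⋆-expandˡ p q = trans (⨟-distribʳ-∪ 𝟙 p q) (cong (_∪ p ⨟ q) (⨟-identityˡ q))

⋆-expandʳ : ∀ p q → q ⨟ p ⋆ ≡ q ∪ q ⨟ p
⋆-expandʳ p q = trans (⨟-distribˡ-∪ q 𝟙 p) (cong (_∪ q ⨟ p) (⨟-identityʳ q))

⋆-indˡ : ∀ {p q r} → q ∪ p ⨟ r ⊆ r → p ⋆ ⨟ q ⊆ r
⋆-indˡ {p} {q} {r} h =
  subst (_⊆ r) (sym (⋆-expandˡ p q)) (∪-least q⊆r (⊆-trans (⨟-mono-⊆ ⊆-refl q⊆r) p⨟r⊆r))
  where
  q⊆r : q ⊆ r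
  q⊆r = ⊆-trans (p⊆p∪q q (p ⨟ r)) h
  p⨟r⊆r : p ⨟ r ⊆ r
  p⨟r⊆r = ⊆-trans (q⊆p∪q q (p ⨟ r)) h

⋆-indʳ : ∀ {p q r} → q ∪ r ⨟ p ⊆ r → q ⨟ p ⋆ ⊆ r
⋆-indʳ {p} {q} {r} h =
  subst (_⊆ r) (sym (⋆-expandʳ p q)) (∪-least q⊆r (⊆-trans (⨟-mono-⊆ q⊆r ⊆-refl) r⨟p⊆r))
  where
  q⊆r : q ⊆ r
  q⊆r = ⊆-trans (p⊆p∪q q (r ⨟ p)) h
  r⨟p⊆r : r ⨟ p ⊆ r
  r⨟p⊆r = ⊆-trans (q⊆p∪q q (r ⨟ p)) h

data IsTest : Rel → Set where
  downset : ∀ {a₁ a₂ a₃} → a₃ ≤ a₁ → a₃ ≤ a₂ → IsTest (rel a₁ a₂ a₃ false)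

-- Heyting implication of down-sets: it holds at a point when a ⇒ᵇ c holds at every point below it.
_⇨_ : Rel → Rel → Rel
rel a₁ a₂ a₃ _ ⇨ rel c₁ c₂ c₃ _ =
  rel (a₁ ⇒ᵇ c₁) (a₂ ⇒ᵇ c₂) ((a₁ ⇒ᵇ c₁) ∧ (a₂ ⇒ᵇ c₂) ∧ (a₃ ⇒ᵇ c₃)) false

IsTest-∪ : ∀ {a b} → IsTest a → IsTest b → IsTest (a ∪ b)
IsTest-∪ (downset g₁ g₂) (downset h₁ h₂) = downset (∨-mono-≤ g₁ h₁) (∨-mono-≤ g₂ h₂)

IsTest-⨟ : ∀ {a b} → IsTest a → IsTest b → IsTest (a ⨟ b)
IsTest-⨟ (downset g₁ g₂) (downset h₁ h₂) = downset (∧-mono-≤ g₁ h₁) (∧-mono-≤ g₂ h₂)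

IsTest-⇨ : ∀ a c → IsTest (a ⇨ c)
IsTest-⇨ (rel a₁ _ _ _) (rel c₁ _ _ _) =
  downset (x∧y≤x _ _) (≤-trans (x∧y≤y (a₁ ⇒ᵇ c₁) _) (x∧y≤x _ _))

IsTest⇒⊆𝟙 : ∀ {a} → IsTest a → a ⊆ 𝟙
IsTest⇒⊆𝟙 (downset _ _) = ⊆-rel (≤-maximum _) (≤-maximum _) (≤-maximum _) ≤-refl

IsTest-⨟-comm : ∀ {a b} → IsTest a → IsTest b → a ⨟ b ≡ b ⨟ a
IsTest-⨟-comm {rel a₁ a₂ a₃ _} {rel b₁ b₂ b₃ _} (downset _ _) (downset _ _) =
  rel-cong (∧-comm a₁ b₁) (∧-comm a₂ b₂) (∧-comm a₃ b₃) refl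

⨟-residual→ : ∀ {a b c} → IsTest b → a ⨟ b ⊆ c → b ⊆ a ⇨ c
⨟-residual→ {rel a₁ a₂ _ _} {rel b₁ b₂ _ _} {rel c₁ c₂ _ _}
            (downset b₃≤b₁ b₃≤b₂) (⊆-rel h₁ h₂ h₃ _) =
  ⊆-rel b₁≤ b₂≤ (∧-greatest (≤-trans b₃≤b₁ b₁≤) (∧-greatest (≤-trans b₃≤b₂ b₂≤) (∧-residual→ h₃))) ≤-refl
  where
  b₁≤ : b₁ ≤ a₁ ⇒ᵇ c₁
  b₁≤ = ∧-residual→ h₁
  b₂≤ : b₂ ≤ a₂ ⇒ᵇ c₂
  b₂≤ = ∧-residual→ h₂

⨟-residual← : ∀ {a b c} → IsTest a → IsTest b → b ⊆ a ⇨ c → a ⨟ b ⊆ c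
⨟-residual← {rel a₁ a₂ _ _} {c = rel c₁ c₂ _ c₂₃} (downset _ _) (downset _ _) (⊆-rel h₁ h₂ h₃ _) =
  ⊆-rel (∧-residual← h₁) (∧-residual← h₂)
        (∧-residual← (≤-trans h₃ (≤-trans (x∧y≤y (a₁ ⇒ᵇ c₁) _) (x∧y≤y (a₂ ⇒ᵇ c₂) _))))
        (≤-minimum c₂₃)

relGKAT : GKAT 0ℓ 0ℓ
relGKAT = record
  { K = Rel ; T = IsTest ; _+_ = _∪_ ; _⨾_ = _⨟_ ; _* = _⋆ ; 0# = ∅ ; 1# = 𝟙
  ; 0∈T = downset ≤-refl ≤-refl
  ; 1∈T = downset ≤-refl ≤-refl
  ; +-closed = IsTest-∪
  ; ⨾-closed = IsTest-⨟
  ; _⇒_ = λ {a} {c} _ _ → a ⇨ c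
  ; ⇒-closed = λ {a} {c} _ _ → IsTest-⇨ a c
  ; +-assoc = ∪-assoc
  ; +-comm = ∪-comm
  ; ⨾-assoc = ⨟-assoc
  ; ⨾-identityʳ = ⨟-identityʳ
  ; ⨾-identityˡ = ⨟-identityˡ
  ; distribˡ = ⨟-distribˡ-∪
  ; distribʳ = ⨟-distribʳ-∪
  ; zeroʳ = ⨟-zeroʳ
  ; zeroˡ = ⨟-zeroˡ
  ; star-unfold = ⋆-unfold
  ; star-indˡ = λ p q r h → ⊆⇒∪≡ (⋆-indˡ {p} {q} {r} (∪≡⇒⊆ h))
  ; star-indʳ = λ p q r h → ⊆⇒∪≡ (⋆-indʳ {p} {q} {r} (∪≡⇒⊆ h))
  ; residual→ = λ _ tb _ h → ⊆⇒∪≡ (⨟-residual→ tb (∪≡⇒⊆ h))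
  ; residual← = λ ta tb _ h → ⊆⇒∪≡ (⨟-residual← ta tb (∪≡⇒⊆ h))
  ; test-≤1 = λ ta → ⊆⇒∪≡ (IsTest⇒⊆𝟙 ta)
  ; test-comm = IsTest-⨟-comm
  }

lemma7 : Σ (GKAT 0ℓ 0ℓ) λ G → let open GKAT G in
    Σ K λ b → Σ (T b) λ tb → Σ K λ p →
    (b ⨾ p ⨾ (tb ⇒ 0∈T) + (tb ⇒ 0∈T) ⨾ p ⨾ b ≡ 0#)
    × ((tb ⇒ 0∈T) ⨾ p ≢ p ⨾ (tb ⇒ 0∈T))
lemma7 = relGKAT , rel true false false false , downset f≤t ≤-refl ,
         rel false false false true , refl , λ ()
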